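{- Let $F\colon \mathcal{C}\to\mathcal{D}$ be left adjoint to $G\colon\mathcal{D}\to\mathcal{C}$, with unit $\eta\colon \mathrm{Id}\Rightarrow GF$ and counit $\varepsilon\colon FG\Rightarrow\mathrm{Id}$. Let $H$ be an endofunctor on $\mathcal{C}$, $L$ an endofunctor on $\mathcal{D}$, and $\rho\colon HG\Rightarrow GL$ a natural transformation. Suppose $L$ has a final coalgebra $\zeta\colon\Psi\xrightarrow{\cong}L(\Psi)$. Then for every $H$-coalgebra $c\colon X\to H(X)$ there is a unique coalgebra-to-algebra morphism $c^\dagger\colon X\to G(\Psi)$ from $(X,c)$ to the $H$-algebra $G(\zeta^{ -1})\circ\rho_\Psi\colon HG(\Psi)\to G(\Psi)$, i.e. a unique $c^\dagger$ with $c^\dagger = G(\zeta^{ -1})\circ\rho_\Psi\circ H(c^\dagger)\circ c$. Moreover, the adjoint transpose $\overline{c^\dagger}\colon F(X)\to\Psi$ of $c^\dagger$ is the unique coalgebra-to-algebra morphism from the $L$-coalgebra $(\rho_2)_X\circ F(c)\colon F(X)\to LF(X)$ to the $L$-algebra $\zeta^{ -1}\colon L(\Psi)\to\Psi$; equivalently, $\overline{c^\dagger}$ is the unique $L$-coalgebra homomorphism from $(F(X),(\rho_2)_X\circ F(c))$ to the final coalgebra $(\Psi,\zeta)$.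
   Context: For an endofunctor $K$ on a category, a coalgebra-to-algebra morphism from a $K$-coalgebra $c\colon X\to K(X)$ to a $K$-algebra $a\colon K(\Theta)\to\Theta$ is a map $f\colon X\to\Theta$ with $f=a\circ K(f)\circ c$. The natural transformation $\rho_2\colon FH\Rightarrow LF$ (the mate of $\rho$) is defined by $\rho_2=\varepsilon LF\circ F\rho F\circ FH\eta$. Adjoint transposition is the bijection $\mathcal{D}(F(X),Y)\cong\mathcal{C}(X,G(Y))$ of the adjunction. -}

module Defs where

open import Level using (Level; _⊔_; suc)
open import Relation.Binary using (IsEquivalence)
open import Data.Product using (Σ; _×_; _,_)

record Category (o ℓ e : Level) : Set (suc (o ⊔ ℓ ⊔ e)) where
  infixr 9 _∘_
  infix  4 _≈_
  field
    Obj   : Set o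
    _⇒_   : Obj → Obj → Set ℓ
    _≈_   : ∀ {A B} → A ⇒ B → A ⇒ B → Set e
    id    : ∀ {A} → A ⇒ A
    _∘_   : ∀ {A B C} → B ⇒ C → A ⇒ B → A ⇒ C
    equiv : ∀ {A B} → IsEquivalence (_≈_ {A} {B})
    assoc : ∀ {A B C D} {f : A ⇒ B} {g : B ⇒ C} {h : C ⇒ D} →
            (h ∘ g) ∘ f ≈ h ∘ (g ∘ f)
    identityˡ : ∀ {A B} {f : A ⇒ B} → id ∘ f ≈ f
    identityʳ : ∀ {A B} {f : A ⇒ B} → f ∘ id ≈ f
    ∘-resp-≈  : ∀ {A B C} {f h : B ⇒ C} {g i : A ⇒ B} →
                f ≈ h → g ≈ i → f ∘ g ≈ h ∘ i

record Functor {o ℓ e o′ ℓ′ e′ : Level}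
               (C : Category o ℓ e) (D : Category o′ ℓ′ e′)
               : Set (o ⊔ ℓ ⊔ e ⊔ o′ ⊔ ℓ′ ⊔ e′) where
  private
    module C = Category C
    module D = Category D
  field
    F₀ : C.Obj → D.Obj
    F₁ : ∀ {A B} → A C.⇒ B → F₀ A D.⇒ F₀ B
    identity     : ∀ {A} → F₁ (C.id {A}) D.≈ D.id
    homomorphism : ∀ {X Y Z} {f : X C.⇒ Y} {g : Y C.⇒ Z} →
                   F₁ (g C.∘ f) D.≈ F₁ g D.∘ F₁ f
    F-resp-≈     : ∀ {A B} {f g : A C.⇒ B} → f C.≈ g → F₁ f D.≈ F₁ g

module _ {o ℓ e : Level} where
  IdF : (C : Category o ℓ e) → Functor C C
  IdF C = record
    { F₀ = λ A → A ; F₁ = λ f → f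
    ; identity = IsEquivalence.refl equiv
    ; homomorphism = IsEquivalence.refl equiv
    ; F-resp-≈ = λ p → p }
    where open Category C

infixr 9 _∘F_
_∘F_ : ∀ {o ℓ e o′ ℓ′ e′ o″ ℓ″ e″}
         {C : Category o ℓ e} {D : Category o′ ℓ′ e′} {E : Category o″ ℓ″ e″} →
       Functor D E → Functor C D → Functor C E
_∘F_ {E = E} G F = record
  { F₀ = λ A → G.F₀ (F.F₀ A)
  ; F₁ = λ f → G.F₁ (F.F₁ f)
  ; identity = IsEquivalence.trans equiv (G.F-resp-≈ F.identity) G.identity
  ; homomorphism = IsEquivalence.trans equiv (G.F-resp-≈ F.homomorphism) G.homomorphism
  ; F-resp-≈ = λ p → G.F-resp-≈ (F.F-resp-≈ p) }
  where
    module F = Functor F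
    module G = Functor G
    open Category E

record NaturalTransformation {o ℓ e o′ ℓ′ e′ : Level}
       {C : Category o ℓ e} {D : Category o′ ℓ′ e′}
       (F G : Functor C D) : Set (o ⊔ ℓ ⊔ e ⊔ o′ ⊔ ℓ′ ⊔ e′) where
  private
    module C = Category C
    module D = Category D
    module F = Functor F
    module G = Functor G
  field
    η       : ∀ X → F.F₀ X D.⇒ G.F₀ X
    commute : ∀ {X Y} (f : X C.⇒ Y) → η Y D.∘ F.F₁ f D.≈ G.F₁ f D.∘ η X

record Adjunction {o ℓ e o′ ℓ′ e′ : Level}
       {C : Category o ℓ e} {D : Category o′ ℓ′ e′}
       (F : Functor C D) (G : Functor D C) : Set (o ⊔ ℓ ⊔ e ⊔ o′ ⊔ ℓ′ ⊔ e′) where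
  private
    module C = Category C
    module D = Category D
    module F = Functor F
    module G = Functor G
  field
    unit   : NaturalTransformation (IdF C) (G ∘F F)
    counit : NaturalTransformation (F ∘F G) (IdF D)
  module unit = NaturalTransformation unit
  module counit = NaturalTransformation counit
  field
    zig : ∀ {A} → counit.η (F.F₀ A) D.∘ F.F₁ (unit.η A) D.≈ D.id
    zag : ∀ {B} → G.F₁ (counit.η B) C.∘ unit.η (G.F₀ B) C.≈ C.id

  transpose : ∀ {X Y} → X C.⇒ G.F₀ Y → F.F₀ X D.⇒ Y
  transpose {Y = Y} f = counit.η Y D.∘ F.F₁ f

module _ {o ℓ e : Level} {C : Category o ℓ e} (K : Functor C C) where
  open Category C
  open Functor K

  IsCoalgToAlg : ∀ {X Θ} → X ⇒ F₀ X → F₀ Θ ⇒ Θ → X ⇒ Θ → Set e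
  IsCoalgToAlg c a f = f ≈ a ∘ F₁ f ∘ c

  IsCoalgHom : ∀ {X Y} → X ⇒ F₀ X → Y ⇒ F₀ Y → X ⇒ Y → Set e
  IsCoalgHom c d h = d ∘ h ≈ F₁ h ∘ c

  record FinalCoalgebra : Set (o ⊔ ℓ ⊔ e) where
    field
      Ψ     : Obj
      ζ     : Ψ ⇒ F₀ Ψ
      ζ⁻¹   : F₀ Ψ ⇒ Ψ
      isoˡ  : ζ⁻¹ ∘ ζ ≈ id
      isoʳ  : ζ ∘ ζ⁻¹ ≈ id
      !     : ∀ {X} (c : X ⇒ F₀ X) → X ⇒ Ψ
      !-hom : ∀ {X} (c : X ⇒ F₀ X) → IsCoalgHom c ζ (! c)
      !-unique : ∀ {X} (c : X ⇒ F₀ X) (h : X ⇒ Ψ) → IsCoalgHom c ζ h → h ≈ ! c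

-- ρ₂ : FH ⇒ LF,  (ρ₂)_X = ε_{LFX} ∘ F(ρ_{FX}) ∘ FH(η_X)   (mate of ρ)
module _ {o ℓ e o′ ℓ′ e′ : Level}
         {C : Category o ℓ e} {D : Category o′ ℓ′ e′}
         {F : Functor C D} {G : Functor D C} (adj : Adjunction F G)
         (H : Functor C C) (L : Functor D D)
         (ρ : NaturalTransformation (H ∘F G) (G ∘F L)) where
  private
    module D = Category D
    module F = Functor F
    module H = Functor H
    module L = Functor L
    open Adjunction adj
    module ρ = NaturalTransformation ρ

  ρ₂ : ∀ X → F.F₀ (H.F₀ X) D.⇒ L.F₀ (F.F₀ X)
  ρ₂ X = counit.η (L.F₀ (F.F₀ X)) D.∘ F.F₁ (ρ.η (F.F₀ X)) D.∘ F.F₁ (H.F₁ (unit.η X))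

-- Transposition along F ⊣ G turns the H-coalgebra-to-algebra equation
-- g = G(b) ∘ ρ ∘ H(g) ∘ c into the L-coalgebra-to-algebra equation
-- ḡ = b ∘ L(ḡ) ∘ ρ₂ ∘ F(c), for any L-algebra b; this is the defining property of the
-- mate ρ₂. Since ζ is invertible, coalgebra-to-algebra morphisms into ζ⁻¹ are exactly
-- coalgebra homomorphisms into ζ, of which there is exactly one by finality.
-- Transposing it back gives c†.
module Submission where

open import Defs
open import Data.Product using (Σ; _×_; _,_)
open import Relation.Binary using (IsEquivalence; Setoid)
import Relation.Binary.Reasoning.Setoid as SetoidReasoning

module HomReasoning {o ℓ e} (C : Category o ℓ e) where
  open Category C public
  open module Equiv {A B} = IsEquivalence (equiv {A} {B}) public

  hom-setoid : ∀ {A B} → Setoid ℓ e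
  hom-setoid {A} {B} = record { Carrier = A ⇒ B ; _≈_ = _≈_ ; isEquivalence = equiv }

  module R {A B} = SetoidReasoning (hom-setoid {A} {B})

  ∘-resp-≈ˡ : ∀ {A B C} {f h : B ⇒ C} {g : A ⇒ B} → f ≈ h → f ∘ g ≈ h ∘ g
  ∘-resp-≈ˡ p = ∘-resp-≈ p refl

  ∘-resp-≈ʳ : ∀ {A B C} {f : B ⇒ C} {g i : A ⇒ B} → g ≈ i → f ∘ g ≈ f ∘ i
  ∘-resp-≈ʳ p = ∘-resp-≈ refl p

  sym-assoc : ∀ {A B C D} {f : A ⇒ B} {g : B ⇒ C} {h : C ⇒ D} →
              h ∘ (g ∘ f) ≈ (h ∘ g) ∘ f
  sym-assoc = sym assoc

module CoalgebraProperties {o ℓ e} {C : Category o ℓ e} (K : Functor C C) where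
  open HomReasoning C
  open Functor K

  IsCoalgHom-resp-≈ : ∀ {X Y} {c : X ⇒ F₀ X} {d : Y ⇒ F₀ Y} {h k : X ⇒ Y} →
                      h ≈ k → IsCoalgHom K c d h → IsCoalgHom K c d k
  IsCoalgHom-resp-≈ {c = c} {d} {h} {k} h≈k hom = begin
      d ∘ k       ≈⟨ ∘-resp-≈ʳ (sym h≈k) ⟩
      d ∘ h       ≈⟨ hom ⟩
      F₁ h ∘ c    ≈⟨ ∘-resp-≈ˡ (F-resp-≈ h≈k) ⟩
      F₁ k ∘ c    ∎
    where open R

  module _ {Ψ} {ζ : Ψ ⇒ F₀ Ψ} {ζ⁻¹ : F₀ Ψ ⇒ Ψ} {X} {c : X ⇒ F₀ X} {h : X ⇒ Ψ} where

    coalgToAlg⇒coalgHom : ζ ∘ ζ⁻¹ ≈ id → IsCoalgToAlg K c ζ⁻¹ h → IsCoalgHom K c ζ h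
    coalgToAlg⇒coalgHom isoʳ p = begin
        ζ ∘ h                        ≈⟨ ∘-resp-≈ʳ p ⟩
        ζ ∘ ζ⁻¹ ∘ F₁ h ∘ c           ≈⟨ sym-assoc ⟩
        (ζ ∘ ζ⁻¹) ∘ F₁ h ∘ c         ≈⟨ ∘-resp-≈ˡ isoʳ ⟩
        id ∘ F₁ h ∘ c                ≈⟨ identityˡ ⟩
        F₁ h ∘ c                     ∎
      where open R

    coalgHom⇒coalgToAlg : ζ⁻¹ ∘ ζ ≈ id → IsCoalgHom K c ζ h → IsCoalgToAlg K c ζ⁻¹ h
    coalgHom⇒coalgToAlg isoˡ p = begin
        h                            ≈⟨ sym identityˡ ⟩
        id ∘ h                       ≈⟨ ∘-resp-≈ˡ (sym isoˡ) ⟩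
        (ζ⁻¹ ∘ ζ) ∘ h                ≈⟨ assoc ⟩
        ζ⁻¹ ∘ ζ ∘ h                  ≈⟨ ∘-resp-≈ʳ p ⟩
        ζ⁻¹ ∘ F₁ h ∘ c               ∎
      where open R

  module _ (fin : FinalCoalgebra K) {X} (c : X ⇒ F₀ X) where
    open FinalCoalgebra fin

    coalgToAlg-unique : ∀ h → IsCoalgToAlg K c ζ⁻¹ h → h ≈ ! c
    coalgToAlg-unique h p = !-unique c h (coalgToAlg⇒coalgHom isoʳ p)

module AdjunctionProperties {o ℓ e o′ ℓ′ e′} {C : Category o ℓ e} {D : Category o′ ℓ′ e′}
    {F : Functor C D} {G : Functor D C} (adj : Adjunction F G) where
  private
    module C = HomReasoning C
    module D = HomReasoning D
    module F = Functor F
    module G = Functor G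
  open Adjunction adj

  untranspose : ∀ {X Y} → F.F₀ X D.⇒ Y → X C.⇒ G.F₀ Y
  untranspose {X} h = G.F₁ h C.∘ unit.η X

  untranspose-transpose : ∀ {X Y} (g : X C.⇒ G.F₀ Y) → untranspose (transpose g) C.≈ g
  untranspose-transpose {X} {Y} g = begin
      G.F₁ (counit.η Y D.∘ F.F₁ g) C.∘ unit.η X
    ≈⟨ C.∘-resp-≈ˡ G.homomorphism ⟩
      (G.F₁ (counit.η Y) C.∘ G.F₁ (F.F₁ g)) C.∘ unit.η X
    ≈⟨ C.assoc ⟩
      G.F₁ (counit.η Y) C.∘ G.F₁ (F.F₁ g) C.∘ unit.η X
    ≈⟨ C.∘-resp-≈ʳ (C.sym (unit.commute g)) ⟩
      G.F₁ (counit.η Y) C.∘ unit.η (G.F₀ Y) C.∘ g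
    ≈⟨ C.sym-assoc ⟩
      (G.F₁ (counit.η Y) C.∘ unit.η (G.F₀ Y)) C.∘ g
    ≈⟨ C.∘-resp-≈ˡ zag ⟩
      C.id C.∘ g
    ≈⟨ C.identityˡ ⟩
      g ∎
    where open C.R

  transpose-untranspose : ∀ {X Y} (h : F.F₀ X D.⇒ Y) → transpose (untranspose h) D.≈ h
  transpose-untranspose {X} {Y} h = begin
      counit.η Y D.∘ F.F₁ (G.F₁ h C.∘ unit.η X)
    ≈⟨ D.∘-resp-≈ʳ F.homomorphism ⟩
      counit.η Y D.∘ F.F₁ (G.F₁ h) D.∘ F.F₁ (unit.η X)
    ≈⟨ D.sym-assoc ⟩
      (counit.η Y D.∘ F.F₁ (G.F₁ h)) D.∘ F.F₁ (unit.η X)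
    ≈⟨ D.∘-resp-≈ˡ (counit.commute h) ⟩
      (h D.∘ counit.η (F.F₀ X)) D.∘ F.F₁ (unit.η X)
    ≈⟨ D.assoc ⟩
      h D.∘ counit.η (F.F₀ X) D.∘ F.F₁ (unit.η X)
    ≈⟨ D.∘-resp-≈ʳ zig ⟩
      h D.∘ D.id
    ≈⟨ D.identityʳ ⟩
      h ∎
    where open D.R

  transpose-resp-≈ : ∀ {X Y} {g k : X C.⇒ G.F₀ Y} → g C.≈ k → transpose g D.≈ transpose k
  transpose-resp-≈ p = D.∘-resp-≈ʳ (F.F-resp-≈ p)

  untranspose-resp-≈ : ∀ {X Y} {h k : F.F₀ X D.⇒ Y} → h D.≈ k → untranspose h C.≈ untranspose k
  untranspose-resp-≈ p = C.∘-resp-≈ˡ (G.F-resp-≈ p)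

  transpose-injective : ∀ {X Y} {g k : X C.⇒ G.F₀ Y} → transpose g D.≈ transpose k → g C.≈ k
  transpose-injective {g = g} {k} p = begin
      g                          ≈⟨ C.sym (untranspose-transpose g) ⟩
      untranspose (transpose g)  ≈⟨ untranspose-resp-≈ p ⟩
      untranspose (transpose k)  ≈⟨ untranspose-transpose k ⟩
      k                          ∎
    where open C.R

  transpose-naturalˡ : ∀ {X Y Z} (b : Y D.⇒ Z) (g : X C.⇒ G.F₀ Y) →
                       transpose (G.F₁ b C.∘ g) D.≈ b D.∘ transpose g
  transpose-naturalˡ {Y = Y} {Z} b g = begin
      counit.η Z D.∘ F.F₁ (G.F₁ b C.∘ g)             ≈⟨ D.∘-resp-≈ʳ F.homomorphism ⟩
      counit.η Z D.∘ F.F₁ (G.F₁ b) D.∘ F.F₁ g        ≈⟨ D.sym-assoc ⟩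
      (counit.η Z D.∘ F.F₁ (G.F₁ b)) D.∘ F.F₁ g      ≈⟨ D.∘-resp-≈ˡ (counit.commute b) ⟩
      (b D.∘ counit.η Y) D.∘ F.F₁ g                  ≈⟨ D.assoc ⟩
      b D.∘ counit.η Y D.∘ F.F₁ g                    ∎
    where open D.R

  transpose-naturalʳ : ∀ {W X Y} (g : X C.⇒ G.F₀ Y) (k : W C.⇒ X) →
                       transpose (g C.∘ k) D.≈ transpose g D.∘ F.F₁ k
  transpose-naturalʳ {Y = Y} g k = begin
      counit.η Y D.∘ F.F₁ (g C.∘ k)              ≈⟨ D.∘-resp-≈ʳ F.homomorphism ⟩
      counit.η Y D.∘ F.F₁ g D.∘ F.F₁ k           ≈⟨ D.sym-assoc ⟩
      (counit.η Y D.∘ F.F₁ g) D.∘ F.F₁ k         ∎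
    where open D.R

module MateProperties {o ℓ e o′ ℓ′ e′} {C : Category o ℓ e} {D : Category o′ ℓ′ e′}
    {F : Functor C D} {G : Functor D C} (adj : Adjunction F G)
    (H : Functor C C) (L : Functor D D)
    (ρ : NaturalTransformation (H ∘F G) (G ∘F L)) where
  private
    module C = HomReasoning C
    module D = HomReasoning D
    module F = Functor F
    module G = Functor G
    module H = Functor H
    module L = Functor L
    module ρ = NaturalTransformation ρ
  open Adjunction adj
  open AdjunctionProperties adj

  ρ-through-unit : ∀ {X Y} (g : X C.⇒ G.F₀ Y) →
                   ρ.η Y C.∘ H.F₁ g C.≈
                   G.F₁ (L.F₁ (transpose g)) C.∘ ρ.η (F.F₀ X) C.∘ H.F₁ (unit.η X)
  ρ-through-unit {X} {Y} g = begin
      ρ.η Y C.∘ H.F₁ g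
    ≈⟨ C.∘-resp-≈ʳ (H.F-resp-≈ (C.sym (untranspose-transpose g))) ⟩
      ρ.η Y C.∘ H.F₁ (G.F₁ (transpose g) C.∘ unit.η X)
    ≈⟨ C.∘-resp-≈ʳ H.homomorphism ⟩
      ρ.η Y C.∘ H.F₁ (G.F₁ (transpose g)) C.∘ H.F₁ (unit.η X)
    ≈⟨ C.sym-assoc ⟩
      (ρ.η Y C.∘ H.F₁ (G.F₁ (transpose g))) C.∘ H.F₁ (unit.η X)
    ≈⟨ C.∘-resp-≈ˡ (ρ.commute (transpose g)) ⟩
      (G.F₁ (L.F₁ (transpose g)) C.∘ ρ.η (F.F₀ X)) C.∘ H.F₁ (unit.η X)
    ≈⟨ C.assoc ⟩
      G.F₁ (L.F₁ (transpose g)) C.∘ ρ.η (F.F₀ X) C.∘ H.F₁ (unit.η X) ∎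
    where open C.R

  transpose-mate : ∀ {X Y} (g : X C.⇒ G.F₀ Y) →
                   transpose (ρ.η Y C.∘ H.F₁ g) D.≈ L.F₁ (transpose g) D.∘ ρ₂ adj H L ρ X
  transpose-mate {X} {Y} g = begin
      transpose (ρ.η Y C.∘ H.F₁ g)
    ≈⟨ transpose-resp-≈ (ρ-through-unit g) ⟩
      transpose (G.F₁ (L.F₁ (transpose g)) C.∘ ρ.η (F.F₀ X) C.∘ H.F₁ (unit.η X))
    ≈⟨ transpose-naturalˡ (L.F₁ (transpose g)) _ ⟩
      L.F₁ (transpose g) D.∘ transpose (ρ.η (F.F₀ X) C.∘ H.F₁ (unit.η X))
    ≈⟨ D.∘-resp-≈ʳ (D.∘-resp-≈ʳ F.homomorphism) ⟩
      L.F₁ (transpose g) D.∘ ρ₂ adj H L ρ X ∎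
    where open D.R

  module _ {X Y} (c : X C.⇒ H.F₀ X) (b : L.F₀ Y D.⇒ Y) where

    transpose-coalgToAlg-equation : (g : X C.⇒ G.F₀ Y) →
      transpose ((G.F₁ b C.∘ ρ.η Y) C.∘ H.F₁ g C.∘ c) D.≈
      b D.∘ L.F₁ (transpose g) D.∘ ρ₂ adj H L ρ X D.∘ F.F₁ c
    transpose-coalgToAlg-equation g = begin
        transpose ((G.F₁ b C.∘ ρ.η Y) C.∘ H.F₁ g C.∘ c)
      ≈⟨ transpose-resp-≈ (C.trans C.assoc (C.∘-resp-≈ʳ C.sym-assoc)) ⟩
        transpose (G.F₁ b C.∘ (ρ.η Y C.∘ H.F₁ g) C.∘ c)
      ≈⟨ transpose-naturalˡ b _ ⟩
        b D.∘ transpose ((ρ.η Y C.∘ H.F₁ g) C.∘ c)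
      ≈⟨ D.∘-resp-≈ʳ (transpose-naturalʳ _ c) ⟩
        b D.∘ transpose (ρ.η Y C.∘ H.F₁ g) D.∘ F.F₁ c
      ≈⟨ D.∘-resp-≈ʳ (D.∘-resp-≈ˡ (transpose-mate g)) ⟩
        b D.∘ (L.F₁ (transpose g) D.∘ ρ₂ adj H L ρ X) D.∘ F.F₁ c
      ≈⟨ D.∘-resp-≈ʳ D.assoc ⟩
        b D.∘ L.F₁ (transpose g) D.∘ ρ₂ adj H L ρ X D.∘ F.F₁ c ∎
      where open D.R

    transpose-preserves-coalgToAlg : ∀ {g} →
      IsCoalgToAlg H c (G.F₁ b C.∘ ρ.η Y) g →
      IsCoalgToAlg L (ρ₂ adj H L ρ X D.∘ F.F₁ c) b (transpose g)
    transpose-preserves-coalgToAlg {g} p =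
      D.trans (transpose-resp-≈ p) (transpose-coalgToAlg-equation g)

    transpose-reflects-coalgToAlg : ∀ {g} →
      IsCoalgToAlg L (ρ₂ adj H L ρ X D.∘ F.F₁ c) b (transpose g) →
      IsCoalgToAlg H c (G.F₁ b C.∘ ρ.η Y) g
    transpose-reflects-coalgToAlg {g} p =
      transpose-injective (D.trans p (D.sym (transpose-coalgToAlg-equation g)))

theorem2p6 : ∀ {o ℓ e o′ ℓ′ e′} {C : Category o ℓ e} {D : Category o′ ℓ′ e′}
    {F : Functor C D} {G : Functor D C} (adj : Adjunction F G)
    (H : Functor C C) (L : Functor D D)
    (ρ : NaturalTransformation (H ∘F G) (G ∘F L))
    (fin : FinalCoalgebra L) →
    let open FinalCoalgebra fin
        module C = Category C
        module D = Category D
        module F = Functor F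
        module G = Functor G
        module H = Functor H
        open Adjunction adj
        module ρ = NaturalTransformation ρ
        -- the H-algebra  G(ζ⁻¹) ∘ ρ_Ψ : HG(Ψ) → G(Ψ)
        a = G.F₁ ζ⁻¹ C.∘ ρ.η Ψ
    in ∀ {X} (c : X C.⇒ H.F₀ X) →
    Σ (X C.⇒ G.F₀ Ψ) λ c† →
      (IsCoalgToAlg H c a c†
         × (∀ g → IsCoalgToAlg H c a g → g C.≈ c†))
      × (IsCoalgToAlg L (ρ₂ adj H L ρ X D.∘ F.F₁ c) ζ⁻¹ (transpose c†)
         × (∀ h → IsCoalgToAlg L (ρ₂ adj H L ρ X D.∘ F.F₁ c) ζ⁻¹ h → h D.≈ transpose c†))
      × (IsCoalgHom L (ρ₂ adj H L ρ X D.∘ F.F₁ c) ζ (transpose c†)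
         × (∀ h → IsCoalgHom L (ρ₂ adj H L ρ X D.∘ F.F₁ c) ζ h → h D.≈ transpose c†))
theorem2p6 {C = C} {D = D} {F = F} {G = G} adj H L ρ fin {X} c =
  c† , (c†-coalgToAlg , c†-unique) , (c̄†-coalgToAlg , c̄†-coalgToAlg-unique)
     , (c̄†-coalgHom , c̄†-coalgHom-unique)
  where
    open FinalCoalgebra fin
    module C = Category C
    module D = HomReasoning D
    module F = Functor F
    module G = Functor G
    module L = Functor L
    module ρ = NaturalTransformation ρ
    open Adjunction adj using (transpose)
    open AdjunctionProperties adj
    open MateProperties adj H L ρ
    open CoalgebraProperties L

    d : F.F₀ X D.⇒ L.F₀ (F.F₀ X)
    d = ρ₂ adj H L ρ X D.∘ F.F₁ c

    c† : X C.⇒ G.F₀ Ψ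
    c† = untranspose (! d)

    c̄†≈! : transpose c† D.≈ ! d
    c̄†≈! = transpose-untranspose (! d)

    c̄†-coalgHom : IsCoalgHom L d ζ (transpose c†)
    c̄†-coalgHom = IsCoalgHom-resp-≈ (D.sym c̄†≈!) (!-hom d)

    c̄†-coalgHom-unique : ∀ h → IsCoalgHom L d ζ h → h D.≈ transpose c†
    c̄†-coalgHom-unique h p = D.trans (!-unique d h p) (D.sym c̄†≈!)

    c̄†-coalgToAlg : IsCoalgToAlg L d ζ⁻¹ (transpose c†)
    c̄†-coalgToAlg = coalgHom⇒coalgToAlg isoˡ c̄†-coalgHom

    c̄†-coalgToAlg-unique : ∀ h → IsCoalgToAlg L d ζ⁻¹ h → h D.≈ transpose c†
    c̄†-coalgToAlg-unique h p = D.trans (coalgToAlg-unique fin d h p) (D.sym c̄†≈!)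

    c†-coalgToAlg : IsCoalgToAlg H c (G.F₁ ζ⁻¹ C.∘ ρ.η Ψ) c†
    c†-coalgToAlg = transpose-reflects-coalgToAlg c ζ⁻¹ c̄†-coalgToAlg

    c†-unique : ∀ g → IsCoalgToAlg H c (G.F₁ ζ⁻¹ C.∘ ρ.η Ψ) g → g C.≈ c†
    c†-unique g p = transpose-injective
      (c̄†-coalgToAlg-unique (transpose g) (transpose-preserves-coalgToAlg c ζ⁻¹ p))
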